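{- Let $R$ be a TRS over $\Sigma$ such that every ground term is weakly normalising if and only if it is strongly normalising, and let $N$ be the set of normalising ground terms. If the set of congruence classes of the Nerode congruence $\sim_N$ is finite, then the minimal complete deterministic bottom-up tree automaton for $N$ is finite and (viewed as a $\Sigma$-algebra on its states) is a model for $R$.
   Context: For a set $L$ of ground terms, $t_1\sim_L t_2$ iff for every ground context $C[\,]$: $C[t_1]\in L\iff C[t_2]\in L$. A complete deterministic bottom-up tree automaton over $\Sigma$ is a (total) $\Sigma$-algebra on a set of states together with a set of accepting states; it accepts the ground terms evaluating to accepting states. A $\Sigma$-algebra $(A,[\![\cdot]\!])$ is a model for $R$ if $[\![\ell]\!]_\alpha=[\![r]\!]_\alpha$ for all rules $\ell\to r\in R$ and all assignments $\alpha:\mathrm{Var}(\ell)\to A$. -}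

module Defs where

open import Level using (0ℓ)
open import Data.Nat using (ℕ)
open import Data.Fin using (Fin)
open import Data.Vec using (Vec; []; _∷_; lookup; _[_]≔_)
open import Data.Empty using (⊥)
open import Data.Product using (Σ; ∃; _×_)
open import Relation.Nullary using (¬_)
open import Relation.Binary.PropositionalEquality using (_≡_)
open import Relation.Binary.Construct.Closure.ReflexiveTransitive using (Star)
open import Induction.WellFounded using (Acc)
open import Function.Bundles using (_⇔_)

record Signature : Set₁ where
  field
    Sym   : Set
    arity : Sym → ℕ

module _ (Sig : Signature) where
  open Signature Sig

  data Term (V : Set) : Set where
    var : V → Term V
    fun : (f : Sym) → Vec (Term V) (arity f) → Term V

  OTerm : Set
  OTerm = Term ℕ

  GTerm : Set
  GTerm = Term ⊥

  data _occursIn_ {V : Set} (x : V) : Term V → Set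
  data _occursIn*_ {V : Set} (x : V) : ∀ {n} → Vec (Term V) n → Set
  data _occursIn_ {V} x where
    here : x occursIn var x
    there : ∀ {f ts} → x occursIn* ts → x occursIn fun f ts
  data _occursIn*_ {V} x where
    head : ∀ {n t} {ts : Vec (Term V) n} → x occursIn t → x occursIn* (t ∷ ts)
    tail : ∀ {n t} {ts : Vec (Term V) n} → x occursIn* ts → x occursIn* (t ∷ ts)

  record Algebra : Set₁ where
    field
      Carrier : Set
      _≈_     : Carrier → Carrier → Set
      op      : (f : Sym) → Vec Carrier (arity f) → Carrier

  module _ (A : Algebra) where
    open Algebra A
    eval  : OTerm → (ℕ → Carrier) → Carrier
    evals : ∀ {n} → Vec OTerm n → (ℕ → Carrier) → Vec Carrier n
    eval (var x)    α = α x
    eval (fun f ts) α = op f (evals ts α)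
    evals []       α = []
    evals (t ∷ ts) α = eval t α ∷ evals ts α

  subst : (ℕ → GTerm) → OTerm → GTerm
  substs : ∀ {n} → (ℕ → GTerm) → Vec OTerm n → Vec GTerm n
  subst σ (var x)    = σ x
  subst σ (fun f ts) = fun f (substs σ ts)
  substs σ []       = []
  substs σ (t ∷ ts) = subst σ t ∷ substs σ ts

  record TRS : Set₁ where
    field
      Rule      : OTerm → OTerm → Set
      lhs-nonvar : ∀ {l r} → Rule l r → ∀ x → ¬ (l ≡ var x)
      rhs-vars  : ∀ {l r} → Rule l r → ∀ x → x occursIn r → x occursIn l

  module _ (R : TRS) where
    open TRS R

    data _⟶_ : GTerm → GTerm → Set where
      root : ∀ {l r} → Rule l r → (σ : ℕ → GTerm) → subst σ l ⟶ subst σ r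
      arg  : ∀ f (ts : Vec GTerm (arity f)) (i : Fin (arity f)) {u} →
             lookup ts i ⟶ u → fun f ts ⟶ fun f (ts [ i ]≔ u)

    _⟶*_ : GTerm → GTerm → Set
    _⟶*_ = Star _⟶_

    NormalForm : GTerm → Set
    NormalForm t = ¬ (∃ λ u → t ⟶ u)

    WeaklyNormalising : GTerm → Set
    WeaklyNormalising t = ∃ λ u → t ⟶* u × NormalForm u

    StronglyNormalising : GTerm → Set
    StronglyNormalising = Acc (λ u t → t ⟶ u)

    Normalising : GTerm → Set
    Normalising = WeaklyNormalising

  IsModel : Algebra → TRS → Set
  IsModel A R = ∀ {l r} → TRS.Rule R l r → (α : ℕ → Algebra.Carrier A) →
                Algebra._≈_ A (eval A l α) (eval A r α)

  data Context : Set where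
    □   : Context
    -- f(t₁,…,C,…,tₙ) with the hole-context C at position i
    -- (the i-th entry of ts is ignored)
    ctx : (f : Sym) (i : Fin (arity f)) (ts : Vec GTerm (arity f)) → Context → Context

  plug : Context → GTerm → GTerm
  plug □ t = t
  plug (ctx f i ts C) t = fun f (ts [ i ]≔ plug C t)

  Nerode : (GTerm → Set) → GTerm → GTerm → Set
  Nerode L t₁ t₂ = ∀ C → L (plug C t₁) ⇔ L (plug C t₂)

  FinitelyManyClasses : (GTerm → GTerm → Set) → Set
  FinitelyManyClasses _∼_ =
    Σ ℕ λ k → Σ (Fin k → GTerm) λ rep → ∀ t → ∃ λ i → t ∼ rep i

  record DTA : Set₁ where
    field
      algebra   : Algebra
      Accepting : Algebra.Carrier algebra → Set

  FiniteStates : DTA → Set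
  FiniteStates M = Σ ℕ λ k → Σ (Fin k → Carrier) λ st → ∀ q → ∃ λ i → q ≈ st i
    where open Algebra (DTA.algebra M)

  -- The minimal complete DTA for L (Myhill–Nerode): states are the
  -- ∼_L-classes (presented as the setoid of ground terms modulo ∼_L),
  -- f([t₁],…,[tₙ]) = [f(t₁,…,tₙ)], accepting classes = classes of L.
  minimalDTA : (GTerm → Set) → DTA
  minimalDTA L = record
    { algebra = record { Carrier = GTerm ; _≈_ = Nerode L ; op = fun }
    ; Accepting = L }

module Submission where

open import Defs
open import Data.Product using (_×_; _,_)
open import Data.Vec using (Vec; []; _∷_; _[_]≔_)
open import Data.Vec.Properties using (lookup∘update; []≔-idempotent)
open import Function.Bundles using (_⇔_; mk⇔; Equivalence)
open import Relation.Binary.PropositionalEquality as ≡ using (_≡_; refl; cong; cong₂)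
open import Relation.Binary.Construct.Closure.ReflexiveTransitive using (_◅_)
open import Induction.WellFounded using (acc)

-- The minimal automaton is the term algebra modulo ∼_N, and finiteness of its states is
-- exactly the hypothesis. For the model property, [[ℓ]]α and [[r]]α are the ground terms
-- ℓα ⟶ rα, so it suffices that ⟶ ⊆ ∼_N. Rewriting is closed under contexts, and C[s] is
-- normalising iff C[t] is: backwards by prefixing the step, forwards because weak and
-- strong normalisation coincide and strong normalisation is preserved by reduction.

module _ (Sig : Signature) where
  open Signature Sig

  termAlgebra : (GTerm Sig → GTerm Sig → Set) → Algebra Sig
  termAlgebra _∼_ = record { Carrier = GTerm Sig ; _≈_ = _∼_ ; op = fun }

  module _ (_∼_ : GTerm Sig → GTerm Sig → Set) where

    eval-termAlgebra : ∀ t α → eval Sig (termAlgebra _∼_) t α ≡ subst Sig α t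
    evals-termAlgebra : ∀ {n} (ts : Vec (OTerm Sig) n) α →
                        evals Sig (termAlgebra _∼_) ts α ≡ substs Sig α ts
    eval-termAlgebra (var x)    α = refl
    eval-termAlgebra (fun f ts) α = cong (fun f) (evals-termAlgebra ts α)
    evals-termAlgebra []       α = refl
    evals-termAlgebra (t ∷ ts) α = cong₂ _∷_ (eval-termAlgebra t α) (evals-termAlgebra ts α)

    termAlgebra-isModel : (R : TRS Sig) →
      (∀ {l r} → TRS.Rule R l r → ∀ σ → subst Sig σ l ∼ subst Sig σ r) →
      IsModel Sig (termAlgebra _∼_) R
    termAlgebra-isModel R rule⊆∼ {l} {r} rule α
      rewrite eval-termAlgebra l α | eval-termAlgebra r α = rule⊆∼ rule α

  ⊆Nerode : (L : GTerm Sig → Set) {_∼_ : GTerm Sig → GTerm Sig → Set} →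
    (∀ C {s t} → s ∼ t → plug Sig C s ∼ plug Sig C t) →
    (∀ {s t} → s ∼ t → L s ⇔ L t) →
    ∀ {s t} → s ∼ t → Nerode Sig L s t
  ⊆Nerode L plug-mono ∼-preserves-L s∼t C = ∼-preserves-L (plug-mono C s∼t)

  module _ (R : TRS Sig) where

    infix 4 _⟶ᴿ_
    _⟶ᴿ_ : GTerm Sig → GTerm Sig → Set
    _⟶ᴿ_ = _⟶_ Sig R

    plug-⟶ : ∀ C {s t} → s ⟶ᴿ t → plug Sig C s ⟶ᴿ plug Sig C t
    plug-⟶ □ s⟶t = s⟶t
    plug-⟶ (ctx f i ts C) {s} {t} s⟶t =
      ≡.subst (λ us → fun f (ts [ i ]≔ C[s]) ⟶ᴿ fun f us) ([]≔-idempotent ts i)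
        (arg f (ts [ i ]≔ C[s]) i
          (≡.subst (_⟶ᴿ plug Sig C t) (≡.sym (lookup∘update i ts C[s])) (plug-⟶ C s⟶t)))
      where C[s] = plug Sig C s

    WN-⟵ : ∀ {s t} → s ⟶ᴿ t → WeaklyNormalising Sig R t → WeaklyNormalising Sig R s
    WN-⟵ s⟶t (u , t⟶*u , nf) = u , s⟶t ◅ t⟶*u , nf

    SN-⟶ : ∀ {s t} → s ⟶ᴿ t → StronglyNormalising Sig R s → StronglyNormalising Sig R t
    SN-⟶ s⟶t (acc rs) = rs s⟶t

    WN-⟶ : (∀ t → WeaklyNormalising Sig R t ⇔ StronglyNormalising Sig R t) →
      ∀ {s t} → s ⟶ᴿ t → WeaklyNormalising Sig R s → WeaklyNormalising Sig R t
    WN-⟶ WN⇔SN {s} {t} s⟶t wn =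
      Equivalence.from (WN⇔SN t) (SN-⟶ s⟶t (Equivalence.to (WN⇔SN s) wn))

    ⟶⊆Nerode-WN : (∀ t → WeaklyNormalising Sig R t ⇔ StronglyNormalising Sig R t) →
      ∀ {s t} → s ⟶ᴿ t → Nerode Sig (Normalising Sig R) s t
    ⟶⊆Nerode-WN WN⇔SN =
      ⊆Nerode (Normalising Sig R) plug-⟶ (λ s⟶t → mk⇔ (WN-⟶ WN⇔SN s⟶t) (WN-⟵ s⟶t))

corollary7p5 : (Sig : Signature) (R : TRS Sig) →
    (∀ t → WeaklyNormalising Sig R t ⇔ StronglyNormalising Sig R t) →
    FinitelyManyClasses Sig (Nerode Sig (Normalising Sig R)) →
    FiniteStates Sig (minimalDTA Sig (Normalising Sig R))
      × IsModel Sig (DTA.algebra (minimalDTA Sig (Normalising Sig R))) R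
corollary7p5 Sig R WN⇔SN finiteClasses =
    finiteClasses
  , termAlgebra-isModel Sig (Nerode Sig (Normalising Sig R)) R
      (λ rule σ → ⟶⊆Nerode-WN Sig R WN⇔SN (root rule σ))
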